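{- For every $n\ge 1$, $PQ_2(P_n)=\lceil n/3\rceil$, where $P_n$ is the path on $n$ vertices.
   Context: Diffusion on a finite simple graph $G$: a configuration assigns an integer stack size $|v|$ to each vertex; firing a configuration $C$ changes each $v$ simultaneously from $|v|^C$ to $|v|^C + |\{u\in N(v): |u|^C>|v|^C\}| - |\{u\in N(v): |u|^C<|v|^C\}|$. The 0-configuration has all stack sizes $0$. A perturbation of $H\subseteq V(G)$ from the 0-configuration is the step in which every vertex of $H$ sends one chip to each of its neighbours. $H$ is $0_2$-invoking if this perturbation followed by one ordinary firing yields the 0-configuration. $PQ_2(G)=\min\{|H| : H\neq\emptyset,\ H\subseteq V(G) \text{ is } 0_2\text{ -invoking}\}$. -}

module Defs where

open import Data.Bool using (Bool; true; false; if_then_else_; _∨_; T)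
open import Data.Nat as ℕ using (ℕ; suc; _≡ᵇ_)
open import Data.Integer as ℤ using (ℤ; 0ℤ; 1ℤ; -1ℤ; _+_; _-_; _*_)
open import Data.Fin using (Fin; zero; suc; toℕ)
open import Data.Fin.Subset using (Subset; Nonempty; ∣_∣)
open import Data.Vec using (lookup)
open import Data.Product using (_×_; Σ; _,_)
open import Relation.Nullary.Decidable using (⌊_⌋)
open import Relation.Binary.PropositionalEquality using (_≡_; refl; cong₂)
open import Data.Bool.Properties using (∨-comm)

record Graph : Set where
  field
    order : ℕ
    adj   : Fin order → Fin order → Bool
    sym   : ∀ u v → adj u v ≡ adj v u
    irrefl : ∀ v → adj v v ≡ false

open Graph public

-- configurations: integer stack size at each vertex
Config : Graph → Set
Config G = Fin (order G) → ℤ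

zeroConfig : (G : Graph) → Config G
zeroConfig G _ = 0ℤ

sumℤ : ∀ {n} → (Fin n → ℤ) → ℤ
sumℤ {ℕ.zero} f = 0ℤ
sumℤ {suc n} f = f zero + sumℤ (λ i → f (suc i))

-- contribution to v from a neighbour with stack a when v has stack b:
-- +1 if a > b, -1 if a < b, 0 otherwise
flow : ℤ → ℤ → ℤ
flow a b = if ⌊ b ℤ.<? a ⌋ then 1ℤ else (if ⌊ a ℤ.<? b ⌋ then -1ℤ else 0ℤ)

fire : (G : Graph) → Config G → Config G
fire G C v = C v + sumℤ (λ u → if adj G v u then flow (C u) (C v) else 0ℤ)

[_] : Bool → ℤ
[ b ] = if b then 1ℤ else 0ℤ

deg : (G : Graph) → Fin (order G) → ℤ
deg G v = sumℤ (λ u → [ adj G v u ])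

-- perturbation of H from the 0-configuration: every vertex of H sends one
-- chip to each of its neighbours
perturb : (G : Graph) → Subset (order G) → Config G
perturb G H v =
  sumℤ (λ u → [ adj G v u ] * [ lookup H u ]) - [ lookup H v ] * deg G v

Is0₂Invoking : (G : Graph) → Subset (order G) → Set
Is0₂Invoking G H = ∀ v → fire G (perturb G H) v ≡ 0ℤ

PQ₂≡ : Graph → ℕ → Set
PQ₂≡ G k =
  Σ (Subset (order G)) (λ H → Nonempty H × Is0₂Invoking G H × ∣ H ∣ ≡ k)
  × (∀ (H : Subset (order G)) → Nonempty H → Is0₂Invoking G H → k ℕ.≤ ∣ H ∣)

pathAdj : ∀ {n} → Fin n → Fin n → Bool
pathAdj i j = (suc (toℕ i) ≡ᵇ toℕ j) ∨ (suc (toℕ j) ≡ᵇ toℕ i)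

private
  suc≢ᵇ : ∀ m → (suc m ≡ᵇ m) ≡ false
  suc≢ᵇ ℕ.zero = refl
  suc≢ᵇ (suc m) = suc≢ᵇ m

Path : ℕ → Graph
Path n = record
  { order = n
  ; adj = pathAdj
  ; sym = λ u v → ∨-comm (suc (toℕ u) ≡ᵇ toℕ v) (suc (toℕ v) ≡ᵇ toℕ u)
  ; irrefl = λ v → cong₂ _∨_ (suc≢ᵇ (toℕ v)) (suc≢ᵇ (toℕ v))
  }

-- A perfect code H (a set meeting every closed neighbourhood exactly once) is
-- 0₂-invoking: the perturbation puts each vertex of H at -deg and every other
-- vertex at 1, and one firing returns every chip; P_n has a perfect code of size
-- ⌈n/3⌉. Conversely, let H be 0₂-invoking. If N[v] misses H, then v is at 0 and
-- its neighbours are at stacks ≥ 0, so v stays at 0 only if all its neighbours are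
-- at 0, which forces their closed neighbourhoods to miss H as well. As P_n is
-- connected, a nonempty 0₂-invoking set therefore dominates P_n, and a dominating
-- set of P_n has at least n/3 vertices because each vertex dominates at most three.

module Submission where

open import Defs hiding (sym)
open import Data.Nat using (ℕ; _≤_; _+_; _/_)
open import Data.Nat as ℕ using (zero; suc; _<_; _*_; _∸_; z≤n; s≤s)
import Data.Nat.Properties as ℕₚ
import Data.Nat.DivMod as DivMod
open import Data.Integer as ℤ using (ℤ; 0ℤ; 1ℤ; -1ℤ; -_; +≤+; +<+; -<+)
import Data.Integer.Properties as ℤₚ
open import Data.Bool using (Bool; true; false; not; _∨_; T; if_then_else_)
open import Data.Bool.Properties using (T-≡; T-∨)
open import Data.Empty using (⊥; ⊥-elim)
open import Data.Unit using (tt)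
open import Data.Fin using (Fin; zero; suc; toℕ; fromℕ<)
import Data.Fin.Properties as Finₚ
open import Data.Fin.Subset using (Subset; Nonempty; ∣_∣)
open import Data.Vec using (Vec; []; _∷_; lookup; here; there)
open import Data.Vec.Properties using ([]=⇒lookup)
open import Data.Product using (_×_; _,_; proj₁; proj₂)
open import Data.Sum using (_⊎_; inj₁; inj₂)
import Data.Sum as Sum
open import Function using (_∘_)
open import Function.Bundles using (Equivalence)
open import Relation.Nullary using (¬_; yes; no; contradiction)
open import Relation.Binary.PropositionalEquality hiding ([_])

sumℤ-cong : ∀ {n} {f g : Fin n → ℤ} → (∀ i → f i ≡ g i) → sumℤ f ≡ sumℤ g
sumℤ-cong {zero} _ = refl
sumℤ-cong {suc n} f≗g = cong₂ ℤ._+_ (f≗g zero) (sumℤ-cong (f≗g ∘ suc))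

sumℤ-zero : ∀ n → sumℤ {n} (λ _ → 0ℤ) ≡ 0ℤ
sumℤ-zero zero = refl
sumℤ-zero (suc n) = trans (ℤₚ.+-identityˡ _) (sumℤ-zero n)

sumℤ-neg : ∀ {n} (f : Fin n → ℤ) → sumℤ (λ i → - f i) ≡ - sumℤ f
sumℤ-neg {zero} f = refl
sumℤ-neg {suc n} f =
  trans (cong (ℤ._+_ (- f zero)) (sumℤ-neg (f ∘ suc))) (sym (ℤₚ.neg-distrib-+ (f zero) _))

sumℤ-nonneg : ∀ {n} {f : Fin n → ℤ} → (∀ i → 0ℤ ℤ.≤ f i) → 0ℤ ℤ.≤ sumℤ f
sumℤ-nonneg {zero} _ = ℤₚ.≤-refl
sumℤ-nonneg {suc n} f≥0 = ℤₚ.+-mono-≤ (f≥0 zero) (sumℤ-nonneg (f≥0 ∘ suc))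

+-nonneg-≡0 : ∀ {i j} → 0ℤ ℤ.≤ i → 0ℤ ℤ.≤ j → i ℤ.+ j ≡ 0ℤ → i ≡ 0ℤ × j ≡ 0ℤ
+-nonneg-≡0 (+≤+ {n = m} _) (+≤+ _) i+j≡0 =
  cong ℤ.+_ (ℕₚ.m+n≡0⇒m≡0 m (ℤₚ.+-injective i+j≡0)) ,
  cong ℤ.+_ (ℕₚ.m+n≡0⇒n≡0 m (ℤₚ.+-injective i+j≡0))

sumℤ-nonneg-≡0 : ∀ {n} {f : Fin n → ℤ} → (∀ i → 0ℤ ℤ.≤ f i) → sumℤ f ≡ 0ℤ → ∀ i → f i ≡ 0ℤ
sumℤ-nonneg-≡0 {suc n} f≥0 Σ≡0 zero =
  proj₁ (+-nonneg-≡0 (f≥0 zero) (sumℤ-nonneg (f≥0 ∘ suc)) Σ≡0)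
sumℤ-nonneg-≡0 {suc n} f≥0 Σ≡0 (suc i) =
  sumℤ-nonneg-≡0 (f≥0 ∘ suc) (proj₂ (+-nonneg-≡0 (f≥0 zero) (sumℤ-nonneg (f≥0 ∘ suc)) Σ≡0)) i

[b]≥0 : ∀ b → 0ℤ ℤ.≤ [ b ]
[b]≥0 true = +≤+ z≤n
[b]≥0 false = +≤+ z≤n

[a]*[b]≥0 : ∀ a b → 0ℤ ℤ.≤ [ a ] ℤ.* [ b ]
[a]*[b]≥0 true b = subst (0ℤ ℤ.≤_) (sym (ℤₚ.*-identityˡ [ b ])) ([b]≥0 b)
[a]*[b]≥0 false b = +≤+ z≤n

[true]*[b]≡0⇒b≡false : ∀ b → [ true ] ℤ.* [ b ] ≡ 0ℤ → b ≡ false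
[true]*[b]≡0⇒b≡false false _ = refl

[b]*i≡if : ∀ b i → [ b ] ℤ.* i ≡ (if b then i else 0ℤ)
[b]*i≡if true i = ℤₚ.*-identityˡ i
[b]*i≡if false i = refl

flow-> : ∀ {a b} → b ℤ.< a → flow a b ≡ 1ℤ
flow-> {a} {b} b<a with b ℤ.<? a
... | yes _ = refl
... | no b≮a = contradiction b<a b≮a

flow-< : ∀ {a b} → a ℤ.< b → flow a b ≡ -1ℤ
flow-< {a} {b} a<b with b ℤ.<? a | a ℤ.<? b
... | yes b<a | _ = contradiction a<b (ℤₚ.<-asym b<a)
... | no _ | yes _ = refl
... | no _ | no a≮b = contradiction a<b a≮b

0≤i⇒0≤flow[i,0] : ∀ {i} → 0ℤ ℤ.≤ i → 0ℤ ℤ.≤ flow i 0ℤ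
0≤i⇒0≤flow[i,0] (+≤+ {n = zero} _) = +≤+ z≤n
0≤i⇒0≤flow[i,0] (+≤+ {n = suc _} _) = +≤+ z≤n

0≤i⇒flow[i,0]≡0⇒i≡0 : ∀ {i} → 0ℤ ℤ.≤ i → flow i 0ℤ ≡ 0ℤ → i ≡ 0ℤ
0≤i⇒flow[i,0]≡0⇒i≡0 (+≤+ {n = zero} _) _ = refl

0≤i⇒-i<1 : ∀ {i} → 0ℤ ℤ.≤ i → - i ℤ.< 1ℤ
0≤i⇒-i<1 (+≤+ {n = zero} _) = +<+ (s≤s z≤n)
0≤i⇒-i<1 (+≤+ {n = suc _} _) = -<+

1+i≡1⇒i≡0 : ∀ {i} → 0ℤ ℤ.≤ i → 1ℤ ℤ.+ i ≡ 1ℤ → i ≡ 0ℤ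
1+i≡1⇒i≡0 (+≤+ {n = zero} _) _ = refl

T-∨-unless-all-false : ∀ a b c → (a ≡ false → b ≡ false → c ≡ false → ⊥) → T (a ∨ b ∨ c)
T-∨-unless-all-false true _ _ _ = tt
T-∨-unless-all-false false true _ _ = tt
T-∨-unless-all-false false false true _ = tt
T-∨-unless-all-false false false false not-all-false = not-all-false refl refl refl

≤3*⇒[n+2]/3≤ : ∀ {n c} → n ≤ 3 * c → (n + 2) / 3 ≤ c
≤3*⇒[n+2]/3≤ {n} {c} n≤3c = ℕₚ.≤-pred (DivMod.m<n*o⇒m/o<n n+2<[1+c]*3)
  where
  open ℕₚ.≤-Reasoning
  n+2<[1+c]*3 : n + 2 < suc c * 3
  n+2<[1+c]*3 = begin-strict
    n + 2      <⟨ ℕₚ.+-monoʳ-< n (ℕₚ.n<1+n 2) ⟩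
    n + 3      ≡⟨ ℕₚ.+-comm n 3 ⟩
    3 + n      ≤⟨ ℕₚ.+-monoʳ-≤ 3 n≤3c ⟩
    3 + 3 * c  ≡⟨ cong (3 +_) (ℕₚ.*-comm 3 c) ⟩
    suc c * 3  ∎

inflow : (G : Graph) → Config G → Fin (order G) → Fin (order G) → ℤ
inflow G C v u = if adj G v u then flow (C u) (C v) else 0ℤ

nbrCount : (G : Graph) → Subset (order G) → Fin (order G) → ℤ
nbrCount G H v = sumℤ (λ u → [ adj G v u ] ℤ.* [ lookup H u ])

deg-nonneg : ∀ G v → 0ℤ ℤ.≤ deg G v
deg-nonneg G v = sumℤ-nonneg (λ u → [b]≥0 (adj G v u))

module _ (G : Graph) (H : Subset (order G)) where

  nbrCount-nonneg : ∀ v → 0ℤ ℤ.≤ nbrCount G H v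
  nbrCount-nonneg v = sumℤ-nonneg (λ u → [a]*[b]≥0 (adj G v u) (lookup H u))

  nbrCount≡0⇒nbr∉ : ∀ {v} → nbrCount G H v ≡ 0ℤ → ∀ u → adj G v u ≡ true → lookup H u ≡ false
  nbrCount≡0⇒nbr∉ {v} count≡0 u vu =
    [true]*[b]≡0⇒b≡false (lookup H u)
      (subst (λ b → [ b ] ℤ.* [ lookup H u ] ≡ 0ℤ) vu
        (sumℤ-nonneg-≡0 (λ w → [a]*[b]≥0 (adj G v w) (lookup H w)) count≡0 u))

  perturb-∉ : ∀ {v} → lookup H v ≡ false → perturb G H v ≡ nbrCount G H v
  perturb-∉ {v} v∉H rewrite v∉H = ℤₚ.+-identityʳ (nbrCount G H v)

  perturb-∈ : ∀ {v} → lookup H v ≡ true → perturb G H v ≡ nbrCount G H v ℤ.- deg G v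
  perturb-∈ {v} v∈H rewrite v∈H = cong (λ d → nbrCount G H v ℤ.- d) (ℤₚ.*-identityˡ (deg G v))

  Undominated : Fin (order G) → Set
  Undominated v = lookup H v ≡ false × (∀ u → adj G v u ≡ true → lookup H u ≡ false)

  nbrCount-undominated : ∀ {v} → Undominated v → nbrCount G H v ≡ 0ℤ
  nbrCount-undominated {v} (_ , nbrs∉H) = trans (sumℤ-cong term≡0) (sumℤ-zero (order G))
    where
    term≡0 : ∀ u → [ adj G v u ] ℤ.* [ lookup H u ] ≡ 0ℤ
    term≡0 u with adj G v u in vu
    ... | false = refl
    ... | true rewrite nbrs∉H u vu = refl

  -- After the perturbation v is at 0 and its neighbours, lying outside H, are at
  -- their nbrCount ≥ 0; so the inflow into v vanishes only if they are all at 0,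
  -- that is, only if none of them has a neighbour in H.
  undominated-spreads : Is0₂Invoking G H →
    ∀ {v u} → adj G v u ≡ true → Undominated v → Undominated u
  undominated-spreads invoking {v} {u} vu (v∉H , nbrs∉H) = u∉H , nbrCount≡0⇒nbr∉ nbrCount[u]≡0
    where
    P : Config G
    P = perturb G H

    u∉H : lookup H u ≡ false
    u∉H = nbrs∉H u vu

    P≥0 : ∀ {w} → lookup H w ≡ false → 0ℤ ℤ.≤ P w
    P≥0 {w} w∉H = subst (0ℤ ℤ.≤_) (sym (perturb-∉ w∉H)) (nbrCount-nonneg w)

    P[v]≡0 : P v ≡ 0ℤ
    P[v]≡0 = trans (perturb-∉ v∉H) (nbrCount-undominated (v∉H , nbrs∉H))

    inflow≥0 : ∀ w → 0ℤ ℤ.≤ inflow G P v w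
    inflow≥0 w with adj G v w in vw
    ... | true rewrite P[v]≡0 = 0≤i⇒0≤flow[i,0] (P≥0 (nbrs∉H w vw))
    ... | false = +≤+ z≤n

    total-inflow≡0 : sumℤ (inflow G P v) ≡ 0ℤ
    total-inflow≡0 = begin
      sumℤ (inflow G P v)          ≡⟨ sym (ℤₚ.+-identityˡ _) ⟩
      0ℤ ℤ.+ sumℤ (inflow G P v)   ≡⟨ cong (ℤ._+ sumℤ (inflow G P v)) (sym P[v]≡0) ⟩
      fire G P v                   ≡⟨ invoking v ⟩
      0ℤ                           ∎
      where open ≡-Reasoning

    nbrCount[u]≡0 : nbrCount G H u ≡ 0ℤ
    nbrCount[u]≡0 = trans (sym (perturb-∉ u∉H))
      (0≤i⇒flow[i,0]≡0⇒i≡0 (P≥0 u∉H)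
        (subst (λ p → flow (P u) p ≡ 0ℤ) P[v]≡0
          (subst (λ b → (if b then flow (P u) (P v) else 0ℤ) ≡ 0ℤ) vu
            (sumℤ-nonneg-≡0 inflow≥0 total-inflow≡0 u))))

IsPerfectCode : (G : Graph) → Subset (order G) → Set
IsPerfectCode G H = ∀ v → [ lookup H v ] ℤ.+ nbrCount G H v ≡ 1ℤ

module _ (G : Graph) (H : Subset (order G)) (perfect : IsPerfectCode G H) where

  private
    P : Config G
    P = perturb G H

  perfect-nbrCount-∉ : ∀ {v} → lookup H v ≡ false → nbrCount G H v ≡ 1ℤ
  perfect-nbrCount-∉ {v} v∉H =
    trans (sym (ℤₚ.+-identityˡ _)) (subst (λ b → [ b ] ℤ.+ nbrCount G H v ≡ 1ℤ) v∉H (perfect v))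

  perfect-perturb-∉ : ∀ {v} → lookup H v ≡ false → P v ≡ 1ℤ
  perfect-perturb-∉ v∉H = trans (perturb-∉ G H v∉H) (perfect-nbrCount-∉ v∉H)

  perfect-nbrCount-∈ : ∀ {v} → lookup H v ≡ true → nbrCount G H v ≡ 0ℤ
  perfect-nbrCount-∈ {v} v∈H =
    1+i≡1⇒i≡0 (nbrCount-nonneg G H v) (subst (λ b → [ b ] ℤ.+ nbrCount G H v ≡ 1ℤ) v∈H (perfect v))

  perfect-perturb-∈ : ∀ {v} → lookup H v ≡ true → P v ≡ - deg G v
  perfect-perturb-∈ {v} v∈H = trans (perturb-∈ G H v∈H)
    (trans (cong (ℤ._- deg G v) (perfect-nbrCount-∈ v∈H)) (ℤₚ.+-identityˡ (- deg G v)))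

  -- A vertex of H has stack -deg and only neighbours of stack 1, so it gains deg.
  inflow-∈ : ∀ {v} → lookup H v ≡ true → sumℤ (inflow G P v) ≡ - P v
  inflow-∈ {v} v∈H = begin
    sumℤ (inflow G P v)     ≡⟨ sumℤ-cong inflow≡[adj] ⟩
    deg G v                 ≡⟨ sym (ℤₚ.neg-involutive (deg G v)) ⟩
    - (- deg G v)           ≡⟨ cong -_ (sym (perfect-perturb-∈ v∈H)) ⟩
    - P v                   ∎
    where
    open ≡-Reasoning
    inflow≡[adj] : ∀ u → inflow G P v u ≡ [ adj G v u ]
    inflow≡[adj] u with adj G v u in vu
    ... | false = refl
    ... | true
      rewrite perfect-perturb-∉ (nbrCount≡0⇒nbr∉ G H (perfect-nbrCount-∈ v∈H) u vu)
            | perfect-perturb-∈ v∈H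
      = flow-> (0≤i⇒-i<1 (deg-nonneg G v))

  -- A vertex outside H has stack 1 and loses one chip to its unique neighbour in H.
  inflow-∉ : ∀ {v} → lookup H v ≡ false → sumℤ (inflow G P v) ≡ - P v
  inflow-∉ {v} v∉H = begin
    sumℤ (inflow G P v)
      ≡⟨ sumℤ-cong inflow≡-term ⟩
    sumℤ (λ u → - ([ adj G v u ] ℤ.* [ lookup H u ]))
      ≡⟨ sumℤ-neg (λ u → [ adj G v u ] ℤ.* [ lookup H u ]) ⟩
    - nbrCount G H v
      ≡⟨ cong -_ (perfect-nbrCount-∉ v∉H) ⟩
    - 1ℤ
      ≡⟨ cong -_ (sym (perfect-perturb-∉ v∉H)) ⟩
    - P v ∎
    where
    open ≡-Reasoning
    flow-into-v : ∀ {u} b → lookup H u ≡ b → flow (P u) 1ℤ ≡ - [ b ]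
    flow-into-v {u} true u∈H rewrite perfect-perturb-∈ u∈H = flow-< (0≤i⇒-i<1 (deg-nonneg G u))
    flow-into-v false u∉H rewrite perfect-perturb-∉ u∉H = refl

    inflow≡-term : ∀ u → inflow G P v u ≡ - ([ adj G v u ] ℤ.* [ lookup H u ])
    inflow≡-term u with adj G v u
    ... | false = refl
    ... | true rewrite perfect-perturb-∉ v∉H | ℤₚ.*-identityˡ [ lookup H u ] =
      flow-into-v (lookup H u) refl

  perfectCode⇒0₂Invoking : Is0₂Invoking G H
  perfectCode⇒0₂Invoking v =
    trans (cong (ℤ._+_ (P v)) (inflow≡-P (lookup H v) refl)) (ℤₚ.+-inverseʳ (P v))
    where
    inflow≡-P : ∀ b → lookup H v ≡ b → sumℤ (inflow G P v) ≡ - P v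
    inflow≡-P true = inflow-∈
    inflow≡-P false = inflow-∉

at : ∀ {n} → Vec Bool n → ℕ → Bool
at [] _ = false
at (x ∷ _) zero = x
at (_ ∷ xs) (suc k) = at xs k

-- The entry left of position k, where ℓ stands for a vertex left of position 0.
before : ∀ {n} → Bool → Vec Bool n → ℕ → Bool
before ℓ _ zero = ℓ
before _ xs (suc k) = at xs k

lookup≡at : ∀ {n} (xs : Vec Bool n) i → lookup xs i ≡ at xs (toℕ i)
lookup≡at (x ∷ _) zero = refl
lookup≡at (_ ∷ xs) (suc i) = lookup≡at xs i

path-nbr-sum : ∀ {n} (xs : Vec Bool n) k →
  sumℤ {n} (λ u → if (suc k ℕ.≡ᵇ toℕ u) ∨ (suc (toℕ u) ℕ.≡ᵇ k) then [ at xs (toℕ u) ] else 0ℤ)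
    ≡ [ before false xs k ] ℤ.+ [ at xs (suc k) ]
path-nbr-sum [] zero = refl
path-nbr-sum [] (suc k) = refl
path-nbr-sum (x ∷ []) zero = refl
path-nbr-sum {suc (suc n)} (x ∷ y ∷ xs) zero =
  cong (ℤ._+_ 0ℤ) (trans (cong (ℤ._+_ [ y ]) (sumℤ-zero n)) (ℤₚ.+-identityʳ [ y ]))
path-nbr-sum (x ∷ xs) (suc zero) =
  cong (ℤ._+_ [ x ]) (trans (path-nbr-sum xs zero) (ℤₚ.+-identityˡ _))
path-nbr-sum (x ∷ xs) (suc (suc k)) =
  trans (cong (ℤ._+_ 0ℤ) (path-nbr-sum xs (suc k))) (ℤₚ.+-identityˡ _)

nbrCount-path : ∀ {n} (xs : Subset n) v →
  nbrCount (Path n) xs v ≡ [ before false xs (toℕ v) ] ℤ.+ [ at xs (suc (toℕ v)) ]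
nbrCount-path xs v = trans (sumℤ-cong term≡) (path-nbr-sum xs (toℕ v))
  where
  term≡ : ∀ u →
    [ pathAdj v u ] ℤ.* [ lookup xs u ] ≡ (if pathAdj v u then [ at xs (toℕ u) ] else 0ℤ)
  term≡ u = trans ([b]*i≡if (pathAdj v u) _)
    (cong (λ b → if pathAdj v u then [ b ] else 0ℤ) (lookup≡at xs u))

pathAdj-suc : ∀ {n} {u v : Fin n} → suc (toℕ u) ≡ toℕ v → pathAdj u v ≡ true
pathAdj-suc {u = u} {v} 1+u≡v =
  cong (_∨ (suc (toℕ v) ℕ.≡ᵇ toℕ u)) (Equivalence.to T-≡ (ℕₚ.≡⇒≡ᵇ (suc (toℕ u)) (toℕ v) 1+u≡v))

pathAdj-inv : ∀ {n} {u v : Fin n} → pathAdj u v ≡ true → suc (toℕ u) ≡ toℕ v ⊎ suc (toℕ v) ≡ toℕ u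
pathAdj-inv {u = u} {v} uv =
  Sum.map (ℕₚ.≡ᵇ⇒≡ (suc (toℕ u)) (toℕ v)) (ℕₚ.≡ᵇ⇒≡ (suc (toℕ v)) (toℕ u))
    (Equivalence.to T-∨ (Equivalence.from T-≡ uv))

path-connected : ∀ {n} (P : Fin n → Set) →
  (∀ {u v} → pathAdj u v ≡ true → P u → P v) → ∀ {u v} → P u → P v
path-connected {n} P closed {u} {v} =
  Sum.[ (λ u≤v → proj₁ (climb (toℕ v ∸ toℕ u) (sym (ℕₚ.m∸n+n≡m u≤v))))
      , (λ v≤u → proj₂ (climb (toℕ u ∸ toℕ v) (sym (ℕₚ.m∸n+n≡m v≤u))))
      ] (ℕₚ.≤-total (toℕ u) (toℕ v))
  where
  climb : ∀ d {x y} → toℕ y ≡ d + toℕ x → (P x → P y) × (P y → P x)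
  climb zero {x} {y} y≡x = subst P x≡y , subst P (sym x≡y)
    where
    x≡y : x ≡ y
    x≡y = Finₚ.toℕ-injective (sym y≡x)
  climb (suc d) {x} {y} y≡1+d+x = closed z~y ∘ proj₁ ih , proj₂ ih ∘ closed y~z
    where
    d+x<n : d + toℕ x < n
    d+x<n = ℕₚ.<⇒≤ (subst (_< n) y≡1+d+x (Finₚ.toℕ<n y))
    z : Fin n
    z = fromℕ< d+x<n
    ih : (P x → P z) × (P z → P x)
    ih = climb d (Finₚ.toℕ-fromℕ< d+x<n)
    z~y : pathAdj z y ≡ true
    z~y = pathAdj-suc (trans (cong suc (Finₚ.toℕ-fromℕ< d+x<n)) (sym y≡1+d+x))
    y~z : pathAdj y z ≡ true
    y~z = trans (Graph.sym (Path n) y z) z~y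

0₂Invoking⇒dominating : ∀ {n} {H : Subset n} → Nonempty H → Is0₂Invoking (Path n) H →
  ∀ v → ¬ Undominated (Path n) H v
0₂Invoking⇒dominating {n} {H} (i , i∈H) invoking v undominated-v =
  contradiction (trans (sym ([]=⇒lookup i∈H)) (proj₁ undominated-i)) λ ()
  where
  undominated-i : Undominated (Path n) H i
  undominated-i =
    path-connected (Undominated (Path n) H) (undominated-spreads (Path n) H invoking) undominated-v

PathDominating : ∀ {n} → Bool → Vec Bool n → Set
PathDominating {n} ℓ xs = ∀ k → k < n → T (before ℓ xs k ∨ at xs k ∨ at xs (suc k))

pathDominating-tail : ∀ {n ℓ x} {xs : Vec Bool n} → PathDominating ℓ (x ∷ xs) → PathDominating x xs
pathDominating-tail dom zero k<n = dom 1 (s≤s k<n)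
pathDominating-tail dom (suc k) k<n = dom (suc (suc k)) (s≤s k<n)

pathDominating-size : ∀ {n} ℓ (xs : Vec Bool n) → PathDominating ℓ xs →
  n ≤ (if ℓ then 1 else 0) + 3 * ∣ xs ∣
pathDominating-size _ [] _ = z≤n
pathDominating-size {suc n} ℓ (true ∷ xs) dom = begin
  suc n                          ≤⟨ s≤s (pathDominating-size true xs (pathDominating-tail dom)) ⟩
  2 + 3 * ∣ xs ∣                 ≤⟨ ℕₚ.n≤1+n _ ⟩
  3 + 3 * ∣ xs ∣                 ≡⟨ sym (ℕₚ.*-suc 3 ∣ xs ∣) ⟩
  3 * suc ∣ xs ∣                 ≤⟨ ℕₚ.m≤n+m _ (if ℓ then 1 else 0) ⟩
  (if ℓ then 1 else 0) + 3 * suc ∣ xs ∣ ∎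
  where open ℕₚ.≤-Reasoning
pathDominating-size true (false ∷ xs) dom =
  s≤s (pathDominating-size false xs (pathDominating-tail dom))
pathDominating-size false (false ∷ []) dom = ⊥-elim (dom 0 (s≤s z≤n))
pathDominating-size false (false ∷ false ∷ xs) dom = ⊥-elim (dom 0 (s≤s z≤n))
pathDominating-size {suc (suc n)} false (false ∷ true ∷ xs) dom = begin
  2 + n
    ≤⟨ s≤s (s≤s (pathDominating-size true xs (pathDominating-tail (pathDominating-tail dom)))) ⟩
  3 + 3 * ∣ xs ∣                 ≡⟨ sym (ℕₚ.*-suc 3 ∣ xs ∣) ⟩
  3 * suc ∣ xs ∣                 ∎
  where open ℕₚ.≤-Reasoning

undominated-at : ∀ {n} (xs : Subset n) {k} (k<n : k < n) →
  before false xs k ≡ false → at xs k ≡ false → at xs (suc k) ≡ false →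
  Undominated (Path n) xs (fromℕ< k<n)
undominated-at {n} xs {k} k<n left∉ k∉ right∉ =
  trans (lookup≡at xs v) (trans (cong (at xs) toℕ-v) k∉) , nbrs∉
  where
  v : Fin n
  v = fromℕ< k<n
  toℕ-v : toℕ v ≡ k
  toℕ-v = Finₚ.toℕ-fromℕ< k<n
  nbrs∉ : ∀ u → pathAdj v u ≡ true → lookup xs u ≡ false
  nbrs∉ u vu with pathAdj-inv vu
  ... | inj₁ 1+v≡u = trans (lookup≡at xs u)
    (subst (λ j → at xs j ≡ false) (trans (cong suc (sym toℕ-v)) 1+v≡u) right∉)
  ... | inj₂ 1+u≡v = trans (lookup≡at xs u)
    (subst (λ j → before false xs j ≡ false) (trans (sym toℕ-v) (sym 1+u≡v)) left∉)

dominating⇒pathDominating : ∀ {n} (xs : Subset n) →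
  (∀ v → ¬ Undominated (Path n) xs v) → PathDominating false xs
dominating⇒pathDominating xs dominating k k<n = T-∨-unless-all-false _ _ _
  (λ left∉ k∉ right∉ → dominating (fromℕ< k<n) (undominated-at xs k<n left∉ k∉ right∉))

-- (100)^m 1, (010)^m and (010)^m 01 for n = 3m+1, 3m, 3m+2: the block x (not x) false
-- is aligned with the first entry x of the code it is prepended to, so that the
-- vertex between them is dominated exactly once.
pathCode : ∀ n → Subset n
pathCode zero = []
pathCode (suc zero) = true ∷ []
pathCode (suc (suc zero)) = false ∷ true ∷ []
pathCode (suc (suc (suc n))) = x ∷ not x ∷ false ∷ pathCode n
  where
  x : Bool
  x = at (pathCode n) zero

block-windows : ∀ x →
  [ x ] ℤ.+ ([ false ] ℤ.+ [ not x ]) ≡ 1ℤ ×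
  [ not x ] ℤ.+ ([ x ] ℤ.+ [ false ]) ≡ 1ℤ ×
  [ false ] ℤ.+ ([ not x ] ℤ.+ [ x ]) ≡ 1ℤ
block-windows true = refl , refl , refl
block-windows false = refl , refl , refl

pathCode-window : ∀ n k → k < n →
  [ at (pathCode n) k ] ℤ.+ ([ before false (pathCode n) k ] ℤ.+ [ at (pathCode n) (suc k) ]) ≡ 1ℤ
pathCode-window (suc zero) zero _ = refl
pathCode-window (suc (suc zero)) zero _ = refl
pathCode-window (suc (suc zero)) (suc zero) _ = refl
pathCode-window (suc zero) (suc _) (s≤s ())
pathCode-window (suc (suc zero)) (suc (suc _)) (s≤s (s≤s ()))
pathCode-window (suc (suc (suc n))) zero _ =
  proj₁ (block-windows (at (pathCode n) zero))
pathCode-window (suc (suc (suc n))) (suc zero) _ =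
  proj₁ (proj₂ (block-windows (at (pathCode n) zero)))
pathCode-window (suc (suc (suc n))) (suc (suc zero)) _ =
  proj₂ (proj₂ (block-windows (at (pathCode n) zero)))
pathCode-window (suc (suc (suc n))) (suc (suc (suc zero))) (s≤s (s≤s (s≤s 0<n))) =
  pathCode-window n zero 0<n
pathCode-window (suc (suc (suc n))) (suc (suc (suc (suc k)))) (s≤s (s≤s (s≤s 1+k<n))) =
  pathCode-window n (suc k) 1+k<n

pathCode-perfect : ∀ n → IsPerfectCode (Path n) (pathCode n)
pathCode-perfect n v = begin
  [ lookup C v ] ℤ.+ nbrCount (Path n) C v
    ≡⟨ cong₂ ℤ._+_ (cong [_] (lookup≡at C v)) (nbrCount-path C v) ⟩
  [ at C (toℕ v) ] ℤ.+ ([ before false C (toℕ v) ] ℤ.+ [ at C (suc (toℕ v)) ])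
    ≡⟨ pathCode-window n (toℕ v) (Finₚ.toℕ<n v) ⟩
  1ℤ ∎
  where
  open ≡-Reasoning
  C : Subset n
  C = pathCode n

block-size : ∀ {n} x (xs : Subset n) → ∣ x ∷ not x ∷ false ∷ xs ∣ ≡ suc ∣ xs ∣
block-size true _ = refl
block-size false _ = refl

∣pathCode∣ : ∀ n → ∣ pathCode n ∣ ≡ (n + 2) / 3
∣pathCode∣ zero = refl
∣pathCode∣ (suc zero) = refl
∣pathCode∣ (suc (suc zero)) = refl
∣pathCode∣ (suc (suc (suc n))) = begin
  ∣ pathCode (3 + n) ∣     ≡⟨ block-size (at (pathCode n) zero) (pathCode n) ⟩
  suc ∣ pathCode n ∣       ≡⟨ cong suc (∣pathCode∣ n) ⟩
  suc ((n + 2) / 3)        ≡⟨ sym (DivMod.m/n≡1+[m∸n]/n {3 + n + 2} (s≤s (s≤s (s≤s z≤n)))) ⟩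
  (3 + n + 2) / 3          ∎
  where open ≡-Reasoning

block-nonempty : ∀ {n} x (xs : Subset n) → Nonempty (x ∷ not x ∷ xs)
block-nonempty true _ = zero , here
block-nonempty false _ = suc zero , there here

pathCode-nonempty : ∀ n → Nonempty (pathCode (suc n))
pathCode-nonempty zero = zero , here
pathCode-nonempty (suc zero) = suc zero , there here
pathCode-nonempty (suc (suc n)) = block-nonempty (at (pathCode n) zero) _

mainTheorem7 : ∀ (n : ℕ) → 1 ≤ n → PQ₂≡ (Path n) ((n + 2) / 3)
mainTheorem7 n@(suc m) _ = (pathCode n , pathCode-nonempty m , invoking , ∣pathCode∣ n) , minimal
  where
  invoking : Is0₂Invoking (Path n) (pathCode n)
  invoking = perfectCode⇒0₂Invoking (Path n) (pathCode n) (pathCode-perfect n)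
  minimal : ∀ H → Nonempty H → Is0₂Invoking (Path n) H → (n + 2) / 3 ≤ ∣ H ∣
  minimal H nonempty H-invoking = ≤3*⇒[n+2]/3≤
    (pathDominating-size false H
      (dominating⇒pathDominating H (0₂Invoking⇒dominating nonempty H-invoking)))
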